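{- Let $G$ be a finite simple graph and let $(A_0,A_1,A_2)$ be a valid 3-partition of $E(G)$. Let $\{A,\bar{A}\}=\{A_1,A_2\}$. Let $(x,y,z,w)$ be an $A$-switching path in $G$ and let $y'z'\in E(G)$ be such that $yz',zy'\in E(\overline{G})$. Then: (a) if $x=y'$, then $(x,y,z,w,z')$ is an $A$-pentagon; (b) if $w=z'$, then $(w,z,y,x,y')$ is an $A$-pentagon.
   Context: For distinct vertices $u,v$ write $uv$ for $\{u,v\}$; $uv\in E(\overline{G})$ means $u\neq v$ and $uv\notin E(G)$. Edges $ab,cd\in E(G)$ form an alternating 4-cycle (with opposite edges $ab,cd$) if $bc,da\in E(\overline{G})$. A valid 3-partition of $E(G)$ is a triple $(A_0,A_1,A_2)$ of pairwise disjoint sets (possibly empty) with union $E(G)$ such that for every alternating 4-cycle in $G$, one of its opposite edges lies in $A_1$ and the other in $A_2$. For $\{A,\bar{A}\}=\{A_1,A_2\}$: a 4-tuple $(x,y,z,w)$ of vertices is an $A$-switching path if $xw\in E(\overline{G})$, $xy,zw\in A\cup A_0$ and $yz\in\bar{A}$. A 5-tuple $(a,b,c,d,e)$ of vertices is an $A$-pentagon if $ac,ad,be\in E(\overline{G})$, $ab,ae\in A$, $bc,bd,ec,ed\in\bar{A}$ and $cd\in A\cup A_0$. -}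

module Defs where

open import Data.Nat using (ℕ)
open import Data.Fin using (Fin)
open import Data.Product using (_×_)
open import Data.Sum using (_⊎_)
open import Relation.Nullary using (¬_; Dec)
open import Relation.Binary.PropositionalEquality using (_≡_; _≢_)

record Graph (n : ℕ) : Set₁ where
  field
    Adj     : Fin n → Fin n → Set
    Adj?    : ∀ u v → Dec (Adj u v)
    Adj-sym : ∀ {u v} → Adj u v → Adj v u
    irrefl  : ∀ {u} → ¬ Adj u u

module _ {n : ℕ} (G : Graph n) where
  open Graph G

  NonAdj : Fin n → Fin n → Set
  NonAdj u v = (u ≢ v) × ¬ Adj u v

  -- A set of edges, represented as a symmetric relation contained in Adj
  -- (an unordered pair uv belongs to S iff S u v, equivalently S v u).
  EdgeRel : Set₁
  EdgeRel = Fin n → Fin n → Set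

  record Valid3Partition (A₀ A₁ A₂ : EdgeRel) : Set where
    field
      sym₀ : ∀ {u v} → A₀ u v → A₀ v u
      sym₁ : ∀ {u v} → A₁ u v → A₁ v u
      sym₂ : ∀ {u v} → A₂ u v → A₂ v u
      sub₀ : ∀ {u v} → A₀ u v → Adj u v
      sub₁ : ∀ {u v} → A₁ u v → Adj u v
      sub₂ : ∀ {u v} → A₂ u v → Adj u v
      cover : ∀ {u v} → Adj u v → A₀ u v ⊎ A₁ u v ⊎ A₂ u v
      disj₀₁ : ∀ {u v} → A₀ u v → ¬ A₁ u v
      disj₀₂ : ∀ {u v} → A₀ u v → ¬ A₂ u v
      disj₁₂ : ∀ {u v} → A₁ u v → ¬ A₂ u v
      alt4 : ∀ {a b c d} → Adj a b → Adj c d → NonAdj b c → NonAdj d a →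
             (A₁ a b × A₂ c d) ⊎ (A₂ a b × A₁ c d)

  SwitchingPath : (A₀ A Ā : EdgeRel) → Fin n → Fin n → Fin n → Fin n → Set
  SwitchingPath A₀ A Ā x y z w =
    NonAdj x w × (A x y ⊎ A₀ x y) × (A z w ⊎ A₀ z w) × Ā y z

  Pentagon : (A₀ A Ā : EdgeRel) → Fin n → Fin n → Fin n → Fin n → Fin n → Set
  Pentagon A₀ A Ā a b c d e =
    NonAdj a c × NonAdj a d × NonAdj b e ×
    A a b × A a e ×
    Ā b c × Ā b d × Ā e c × Ā e d ×
    (A c d ⊎ A₀ c d)

-- Each step reads an alternating 4-cycle through the switching path and the
-- edge xz′: since yz ∈ Ā, the 4-cycle (y,z,x,z′) puts xz′ in A. Any missing
-- edge among zz′, yw, z′w would close an alternating 4-cycle whose opposite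
-- edges are an A-edge and an (A ∪ A₀)-edge, which validity forbids; once these
-- edges exist, the 4-cycles through them force the colours of the pentagon.
-- Part (b) is part (a) for the reversed switching path (w,z,y,x).
module Submission where

open import Defs
open import Data.Nat using (ℕ)
open import Data.Fin using (Fin)
open import Data.Product using (_×_; _,_; proj₁; proj₂)
open import Data.Sum using (_⊎_; inj₁; inj₂; swap)
open import Relation.Nullary using (¬_; contradiction; decidable-stable)
open import Relation.Binary.PropositionalEquality using (_≡_; _≢_; refl; ≢-sym)

module _ {n : ℕ} (G : Graph n) where
  open Graph G

  NonAdj-sym : ∀ {u v} → NonAdj G u v → NonAdj G v u
  NonAdj-sym (u≢v , ¬uv) = ≢-sym u≢v , (λ vu → ¬uv (Adj-sym vu))

  NonAdj-Adj⇒≢ : ∀ {u v v′} → NonAdj G u v′ → Adj u v → v′ ≢ v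
  NonAdj-Adj⇒≢ (_ , ¬uv′) uv refl = ¬uv′ uv

  -- A valid 3-partition seen from the side A of {A, Ā} = {A₁, A₂}.
  record OrientedPartition (A₀ A Ā : EdgeRel G) : Set where
    field
      A-sym  : ∀ {u v} → A u v → A v u
      Ā-sym  : ∀ {u v} → Ā u v → Ā v u
      A₀-sym : ∀ {u v} → A₀ u v → A₀ v u
      A⊆E    : ∀ {u v} → A u v → Adj u v
      Ā⊆E    : ∀ {u v} → Ā u v → Adj u v
      A₀⊆E   : ∀ {u v} → A₀ u v → Adj u v
      A-Ā-disjoint  : ∀ {u v} → A u v → ¬ Ā u v
      A₀-Ā-disjoint : ∀ {u v} → A₀ u v → ¬ Ā u v
      alternating : ∀ {a b c d} → Adj a b → Adj c d → NonAdj G b c → NonAdj G d a →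
                    (A a b × Ā c d) ⊎ (Ā a b × A c d)

  module _ {A₀ A₁ A₂ : EdgeRel G} (V : Valid3Partition G A₀ A₁ A₂) where
    open Valid3Partition V

    orient₁ : OrientedPartition A₀ A₁ A₂
    orient₁ = record
      { A-sym = sym₁ ; Ā-sym = sym₂ ; A₀-sym = sym₀
      ; A⊆E = sub₁ ; Ā⊆E = sub₂ ; A₀⊆E = sub₀
      ; A-Ā-disjoint = disj₁₂ ; A₀-Ā-disjoint = disj₀₂
      ; alternating = alt4
      }

    orient₂ : OrientedPartition A₀ A₂ A₁
    orient₂ = record
      { A-sym = sym₂ ; Ā-sym = sym₁ ; A₀-sym = sym₀
      ; A⊆E = sub₂ ; Ā⊆E = sub₁ ; A₀⊆E = sub₀
      ; A-Ā-disjoint = λ a₂ a₁ → disj₁₂ a₁ a₂ ; A₀-Ā-disjoint = disj₀₁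
      ; alternating = λ ab cd bc da → swap (alt4 ab cd bc da)
      }

    orient : ∀ {A Ā} → (A ≡ A₁ × Ā ≡ A₂) ⊎ (A ≡ A₂ × Ā ≡ A₁) → OrientedPartition A₀ A Ā
    orient (inj₁ (refl , refl)) = orient₁
    orient (inj₂ (refl , refl)) = orient₂

  module _ {A₀ A Ā : EdgeRel G} (P : OrientedPartition A₀ A Ā) where
    open OrientedPartition P

    A⁺ : Fin n → Fin n → Set
    A⁺ u v = A u v ⊎ A₀ u v

    A⁺-sym : ∀ {u v} → A⁺ u v → A⁺ v u
    A⁺-sym (inj₁ a)  = inj₁ (A-sym a)
    A⁺-sym (inj₂ a₀) = inj₂ (A₀-sym a₀)

    A⁺⊆E : ∀ {u v} → A⁺ u v → Adj u v
    A⁺⊆E (inj₁ a)  = A⊆E a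
    A⁺⊆E (inj₂ a₀) = A₀⊆E a₀

    A⁺-Ā-disjoint : ∀ {u v} → A⁺ u v → ¬ Ā u v
    A⁺-Ā-disjoint (inj₁ a)  = A-Ā-disjoint a
    A⁺-Ā-disjoint (inj₂ a₀) = A₀-Ā-disjoint a₀

    opposite-Ā⇒A : ∀ {a b c d} → Ā a b → Adj c d → NonAdj G b c → NonAdj G d a → A c d
    opposite-Ā⇒A āab cd bc da with alternating (Ā⊆E āab) cd bc da
    ... | inj₁ (aab , _) = contradiction āab (A-Ā-disjoint aab)
    ... | inj₂ (_ , acd) = acd

    opposite-A⁺⇒Ā×A : ∀ {a b c d} → Adj a b → A⁺ c d → NonAdj G b c → NonAdj G d a →
                      Ā a b × A c d
    opposite-A⁺⇒Ā×A ab a⁺cd bc da with alternating ab (A⁺⊆E a⁺cd) bc da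
    ... | inj₁ (_ , ācd) = contradiction ācd (A⁺-Ā-disjoint a⁺cd)
    ... | inj₂ āab×acd = āab×acd

    -- An A-edge and an (A ∪ A₀)-edge cannot be opposite in an alternating 4-cycle.
    closing-edge : ∀ {a b c d} → A a b → A⁺ c d → NonAdj G b c → d ≢ a → Adj d a
    closing-edge aab a⁺cd bc d≢a = decidable-stable (Adj? _ _) λ ¬da →
      contradiction (opposite-A⁺⇒Ā×A (A⊆E aab) a⁺cd bc (d≢a , ¬da))
                    (λ (āab , _) → A-Ā-disjoint aab āab)

    switchingPath-reverse : ∀ {x y z w} → SwitchingPath G A₀ A Ā x y z w →
                            SwitchingPath G A₀ A Ā w z y x
    switchingPath-reverse (xw , xy , zw , yz) =
      NonAdj-sym xw , A⁺-sym zw , A⁺-sym xy , Ā-sym yz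

    switchingPath⇒pentagon : ∀ {x y z w z′} → SwitchingPath G A₀ A Ā x y z w →
               Adj x z′ → NonAdj G y z′ → NonAdj G z x → Pentagon G A₀ A Ā x y z w z′
    switchingPath⇒pentagon {x} {y} {z} {w} {z′} (xw , xy , zw , ā-yz) xz′ yz′ zx =
      NonAdj-sym zx , xw , yz′ , A-sym a-yx , a-xz′ , ā-yz , Ā-sym ā-wy ,
      Ā-sym ā-zz′ , Ā-sym ā-wz′ , zw
      where
      a-xz′ : A x z′
      a-xz′ = opposite-Ā⇒A ā-yz xz′ zx (NonAdj-sym yz′)

      zz′ : Adj z z′
      zz′ = closing-edge (A-sym a-xz′) (A⁺-sym zw) xw (≢-sym (NonAdj-Adj⇒≢ yz′ (Ā⊆E ā-yz)))

      ā-zz′×a-yx : Ā z z′ × A y x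
      ā-zz′×a-yx = opposite-A⁺⇒Ā×A zz′ (A⁺-sym xy) (NonAdj-sym yz′) (NonAdj-sym zx)

      ā-zz′ : Ā z z′
      ā-zz′ = proj₁ ā-zz′×a-yx

      a-yx : A y x
      a-yx = proj₂ ā-zz′×a-yx

      wy : Adj w y
      wy = closing-edge a-yx zw (NonAdj-sym zx) (NonAdj-Adj⇒≢ xw (A⁺⊆E xy))

      ā-wy : Ā w y
      ā-wy = proj₁ (opposite-A⁺⇒Ā×A wy (inj₁ (A-sym a-xz′)) yz′ xw)

      wz′ : Adj w z′
      wz′ = closing-edge (A-sym a-xz′) zw (NonAdj-sym zx) (NonAdj-Adj⇒≢ xw xz′)

      ā-wz′ : Ā w z′
      ā-wz′ = proj₁ (opposite-A⁺⇒Ā×A wz′ (A⁺-sym xy) (NonAdj-sym yz′) xw)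

lemma2 : {n : ℕ} (G : Graph n) (A₀ A₁ A₂ : EdgeRel G) →
         Valid3Partition G A₀ A₁ A₂ →
         (A Ā : EdgeRel G) →
         ((A ≡ A₁ × Ā ≡ A₂) ⊎ (A ≡ A₂ × Ā ≡ A₁)) →
         (x y z w y′ z′ : Fin n) →
         SwitchingPath G A₀ A Ā x y z w →
         Graph.Adj G y′ z′ →
         NonAdj G y z′ → NonAdj G z y′ →
         (x ≡ y′ → Pentagon G A₀ A Ā x y z w z′) ×
         (w ≡ z′ → Pentagon G A₀ A Ā w z y x y′)
lemma2 G A₀ A₁ A₂ V A Ā side x y z w y′ z′ path y′z′ yz′ zy′ =
  (λ { refl → switchingPath⇒pentagon G P path y′z′ yz′ zy′ }) ,
  (λ { refl → switchingPath⇒pentagon G P (switchingPath-reverse G P path)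
                                       (Graph.Adj-sym G y′z′) zy′ yz′ })
  where
  P : OrientedPartition G A₀ A Ā
  P = orient G V side
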